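{- Let $q$ be a positive integer and for real $t$ define $\pi_t:\mathbb{Z}\to\mathbb{Z}$ by $\pi_t(n) = \lfloor q\{ tn \} \rfloor$, where $\{x\}$ denotes the fractional part of $x$. Let $S$ be a set of integers with $|S| = q$. Then there is a $t\in(0,1)$ such that $| \pi_t(S)| > q/3$. -}

module Defs where

open import Data.Nat using (ℕ)
open import Data.Integer using (ℤ)
open import Data.Rational using (ℚ; _*_; _-_; _/_; floor)

ι : ℤ → ℚ
ι z = z / 1

frac : ℚ → ℚ
frac x = x - ι (floor x)

π : ℕ → ℚ → ℤ → ℤ
π q t n = floor (ι (Data.Integer.+ q) * frac (t * ι n))

-- Let B = ∑ |x| over S and N = M + 1 with M = (2B)!, so that N is coprime to every difference of
-- distinct elements of S. For t = j / N one has π_t(x) = ⌊q r / N⌋ with r = j x mod N, hence a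
-- collision π_t(y) = π_t(x) forces q · (j (x − y) mod N) < N or q · (j (y − x) mod N) < N. Since
-- j ↦ j d mod N is injective on 1..M for d coprime to N and misses 0, an ordered pair x ≠ y
-- collides for at most 2M/q of the M values of j, while the q diagonal pairs always collide. So
-- the average number of ordered collisions is below 3q, and some t has fewer than 3q of them.
-- Summing 6c ≤ 9 + c² over the fibre sizes c of π_t on S then gives
-- 6q ≤ 9 |π_t(S)| + #collisions < 9 |π_t(S)| + 3q.
module Submission where

open import Defs
open import Data.Nat using (ℕ; NonZero)
open import Data.Integer using (ℤ) renaming (_≟_ to _≟ℤ_)
open import Data.Rational using (ℚ; 0ℚ; 1ℚ) renaming (_<_ to _<ℚ_)
open import Data.List using (List; length; map; deduplicate)
open import Data.List.Relation.Unary.Unique.Propositional using (Unique)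
open import Data.Product using (∃; _×_)
open import Relation.Binary.PropositionalEquality using (_≡_)
open import Data.Nat using (_<_; _*_)

open import Data.Nat as ℕ
  using (zero; suc; _+_; _∸_; _≤_; _≤?_; _<?_; z≤n; s≤s; s≤s⁻¹; _!; >-nonZero⁻¹)
open import Data.Nat.Properties
open import Data.Nat.Divisibility using (_∣_; divides; >⇒∤; m≤n⇒m!∣n!; m∣m*n; ∣-trans; ∣m+n∣m⇒∣n; ∣1⇒≡1)
open import Data.Nat.DivMod using (m≡m%n+[m/n]*n; m%n<n)
open import Data.Nat.ListAction using (sum)
open import Data.Nat.Tactic.RingSolver using (solve-∀)
import Data.Nat.Coprimality as ℕ
open import Data.Integer as ℤ using (+_; +<+)
import Data.Integer.Properties as ℤ
open import Data.Integer.DivMod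
  using (_/ℕ_; _%ℕ_; a≡a%ℕn+[a/ℕn]*n; n%ℕd<d; [n/ℕd]*d≤n; n<s[n/ℕd]*d; div-pos-is-/ℕ)
open import Data.Integer.Divisibility using () renaming (_∣_ to _∣ℤ_)
open import Data.Integer.Coprimality using (Coprime; coprime-divisor)
open import Data.Integer.Tactic.RingSolver using () renaming (solve-∀ to ℤ-solve-∀)
open import Algebra.Properties.AbelianGroup ℤ.+-0-abelianGroup using (∙-cancelʳ)
open import Data.Rational as ℚ using (mkℚ; toℚᵘ; floor; _/_)
open import Data.Rational.Properties
  using (toℚᵘ-fromℚᵘ; toℚᵘ-homo-+; toℚᵘ-homo‿-; toℚᵘ-homo-*; toℚᵘ-cancel-<)
open import Data.Rational.Unnormalised as ℚᵘ using (*≡*; *<*; _≃_) renaming (_/_ to _/ᵘ_)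
open import Data.Rational.Unnormalised.Properties as ℚᵘ using (≃-trans; ≃-sym; <-respˡ-≃; <-respʳ-≃)
open import Data.List using ([]; _∷_; applyDownFrom)
open import Data.List.Properties using (length-applyDownFrom)
open import Data.List.Membership.Propositional using (_∈_)
open import Data.List.Membership.Propositional.Properties
  using (∈-map⁺; ∈-deduplicate⁺; ∈-applyDownFrom⁺; ∈-applyDownFrom⁻)
open import Data.List.Relation.Unary.Any using (here; there)
open import Data.List.Relation.Unary.All using (lookup)
open import Data.List.Relation.Unary.AllPairs using (_∷_)
open import Data.List.Relation.Unary.Unique.Propositional.Properties using (applyDownFrom⁺₁)
open import Data.List.Relation.Unary.Unique.DecPropositional.Properties using (deduplicate-!)
open import Data.Product using (_,_; proj₂)
open import Data.Sum using (_⊎_; inj₁; inj₂)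
open import Function using (_∘′_)
open import Relation.Binary.Definitions using (DecidableEquality)
open import Relation.Binary.PropositionalEquality
  using (_≢_; refl; sym; trans; cong; cong₂; subst; subst₂; ≢-sym; module ≡-Reasoning)
open import Relation.Nullary using (Dec; yes; no; ¬_; contradiction)

∑ : {A : Set} → List A → (A → ℕ) → ℕ
∑ xs f = sum (map f xs)

syntax ∑ xs (λ x → e) = ∑[ x ∈ xs ] e

𝟙 : {P : Set} → Dec P → ℕ
𝟙 (yes _) = 1
𝟙 (no _)  = 0

𝟙≤1 : {P : Set} (P? : Dec P) → 𝟙 P? ≤ 1
𝟙≤1 (yes _) = s≤s z≤n
𝟙≤1 (no _)  = z≤n

𝟙-yes : {P : Set} (P? : Dec P) → P → 𝟙 P? ≡ 1
𝟙-yes (yes _) _ = refl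
𝟙-yes (no ¬p) p = contradiction p ¬p

𝟙-no : {P : Set} (P? : Dec P) → ¬ P → 𝟙 P? ≡ 0
𝟙-no (yes p) ¬p = contradiction p ¬p
𝟙-no (no _)  _  = refl

module _ {A : Set} where

  ∑-cong : ∀ {f g : A → ℕ} xs → (∀ {x} → x ∈ xs → f x ≡ g x) → ∑ xs f ≡ ∑ xs g
  ∑-cong []       f≡g = refl
  ∑-cong (x ∷ xs) f≡g = cong₂ _+_ (f≡g (here refl)) (∑-cong xs (f≡g ∘′ there))

  ∑-mono-≤ : ∀ {f g : A → ℕ} xs → (∀ {x} → x ∈ xs → f x ≤ g x) → ∑ xs f ≤ ∑ xs g
  ∑-mono-≤ []       f≤g = z≤n
  ∑-mono-≤ (x ∷ xs) f≤g = +-mono-≤ (f≤g (here refl)) (∑-mono-≤ xs (f≤g ∘′ there))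

  ∑-distrib-+ : ∀ (f g : A → ℕ) xs → ∑[ x ∈ xs ] (f x + g x) ≡ ∑ xs f + ∑ xs g
  ∑-distrib-+ f g []       = refl
  ∑-distrib-+ f g (x ∷ xs) = begin
    f x + g x + ∑[ y ∈ xs ] (f y + g y)  ≡⟨ cong (_+_ (f x + g x)) (∑-distrib-+ f g xs) ⟩
    f x + g x + (∑ xs f + ∑ xs g)        ≡⟨ +-+-comm (f x) (g x) (∑ xs f) (∑ xs g) ⟩
    f x + ∑ xs f + (g x + ∑ xs g)        ∎
    where
    open ≡-Reasoning
    +-+-comm : ∀ a b c d → a + b + (c + d) ≡ a + c + (b + d)
    +-+-comm = solve-∀

  ∑-distribˡ-* : ∀ c (f : A → ℕ) xs → c * ∑ xs f ≡ ∑[ x ∈ xs ] (c * f x)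
  ∑-distribˡ-* c f []       = *-zeroʳ c
  ∑-distribˡ-* c f (x ∷ xs) =
    trans (*-distribˡ-+ c (f x) (∑ xs f)) (cong (_+_ (c * f x)) (∑-distribˡ-* c f xs))

  ∑-distribʳ-* : ∀ c (f : A → ℕ) xs → ∑ xs f * c ≡ ∑[ x ∈ xs ] (f x * c)
  ∑-distribʳ-* c f []       = refl
  ∑-distribʳ-* c f (x ∷ xs) =
    trans (*-distribʳ-+ c (f x) (∑ xs f)) (cong (_+_ (f x * c)) (∑-distribʳ-* c f xs))

  ∑-const : ∀ c (xs : List A) → ∑[ x ∈ xs ] c ≡ length xs * c
  ∑-const c []       = refl
  ∑-const c (x ∷ xs) = cong (_+_ c) (∑-const c xs)

  ∑-zero : ∀ {f : A → ℕ} xs → (∀ {x} → x ∈ xs → f x ≡ 0) → ∑ xs f ≡ 0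
  ∑-zero xs f≡0 = trans (∑-cong xs f≡0) (trans (∑-const 0 xs) (*-zeroʳ (length xs)))

  ∑-bound : ∀ {f : A → ℕ} c xs → (∀ {x} → x ∈ xs → f x ≤ c) → ∑ xs f ≤ length xs * c
  ∑-bound c xs f≤c = ≤-trans (∑-mono-≤ xs f≤c) (≤-reflexive (∑-const c xs))

  ∑-bound-< : ∀ {f : A → ℕ} c xs → 0 < length xs → (∀ {x} → x ∈ xs → f x < c) →
              ∑ xs f < length xs * c
  ∑-bound-< c (x ∷ xs) _ f<c = +-mono-<-≤ (f<c (here refl)) (∑-bound c xs (<⇒≤ ∘′ f<c ∘′ there))

  ∈⇒≤∑ : ∀ (f : A → ℕ) {x xs} → x ∈ xs → f x ≤ ∑ xs f
  ∈⇒≤∑ f {xs = y ∷ ys} (here refl)  = m≤m+n (f y) (∑ ys f)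
  ∈⇒≤∑ f {xs = y ∷ ys} (there x∈ys) = ≤-trans (∈⇒≤∑ f x∈ys) (m≤n+m (∑ ys f) (f y))

  ∑<⇒∃< : ∀ {f : A → ℕ} c xs → ∑ xs f < length xs * c → ∃ λ x → x ∈ xs × f x < c
  ∑<⇒∃< {f} c (x ∷ xs) ∑<
    with f x <? c
  ... | yes fx<c = x , here refl , fx<c
  ... | no  fx≮c with ∑<⇒∃< c xs (+-cancelˡ-< c _ _ (≤-<-trans (+-monoˡ-≤ (∑ xs f) (≮⇒≥ fx≮c)) ∑<))
  ...   | y , y∈xs , fy<c = y , there y∈xs , fy<c

  -- That is, ∑ xs f ≤ a + (length xs ∸ 1) * b, stated without truncated subtraction.
  ∑-≤-except : ∀ {f : A → ℕ} {x} a b xs → Unique xs → x ∈ xs → f x ≤ a →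
               (∀ {y} → y ∈ xs → y ≢ x → f y ≤ b) → ∑ xs f + b ≤ a + length xs * b
  ∑-≤-except {f} a b (z ∷ zs) (z∉zs ∷ _) (here refl) fz≤a f≤b = begin
    f z + ∑ zs f + b         ≤⟨ +-monoˡ-≤ b (+-mono-≤ fz≤a (∑-bound b zs others≤b)) ⟩
    a + length zs * b + b    ≡⟨ +-right-comm a (length zs * b) b ⟩
    a + (b + length zs * b)  ∎
    where
    open ≤-Reasoning
    others≤b : ∀ {y} → y ∈ zs → f y ≤ b
    others≤b y∈zs = f≤b (there y∈zs) (≢-sym (lookup z∉zs y∈zs))
    +-right-comm : ∀ m n o → m + n + o ≡ m + (o + n)
    +-right-comm = solve-∀
  ∑-≤-except {f} a b (z ∷ zs) (z∉zs ∷ unique) (there x∈zs) fx≤a f≤b = begin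
    f z + ∑ zs f + b         ≤⟨ +-monoˡ-≤ b (+-monoˡ-≤ (∑ zs f) (f≤b (here refl) (lookup z∉zs x∈zs))) ⟩
    b + ∑ zs f + b           ≡⟨ +-assoc b (∑ zs f) b ⟩
    b + (∑ zs f + b)         ≤⟨ +-monoʳ-≤ b (∑-≤-except a b zs unique x∈zs fx≤a (f≤b ∘′ there)) ⟩
    b + (a + length zs * b)  ≡⟨ +-left-comm b a (length zs * b) ⟩
    a + (b + length zs * b)  ∎
    where
    open ≤-Reasoning
    +-left-comm : ∀ m n o → m + (n + o) ≡ n + (m + o)
    +-left-comm = solve-∀

module _ {A B : Set} where

  ∑-comm : ∀ (f : A → B → ℕ) xs ys →
           ∑[ x ∈ xs ] ∑[ y ∈ ys ] f x y ≡ ∑[ y ∈ ys ] ∑[ x ∈ xs ] f x y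
  ∑-comm f []       ys = sym (∑-zero ys (λ _ → refl))
  ∑-comm f (x ∷ xs) ys = trans (cong (_+_ (∑ ys (f x))) (∑-comm f xs ys))
                               (sym (∑-distrib-+ (f x) (λ y → ∑[ x ∈ xs ] f x y) ys))

module _ {A B : Set} (_≟_ : DecidableEquality B) where

  ∑-δ : ∀ (h : B → ℕ) {y} ys → Unique ys → y ∈ ys → ∑[ v ∈ ys ] (𝟙 (y ≟ v) * h v) ≡ h y
  ∑-δ h (v ∷ vs) (v∉vs ∷ _) (here refl) = begin
    𝟙 (v ≟ v) * h v + ∑[ u ∈ vs ] (𝟙 (v ≟ u) * h u)
      ≡⟨ cong₂ _+_ (cong (_* h v) (𝟙-yes (v ≟ v) refl))
                   (∑-zero vs (λ u∈vs → cong (_* _) (𝟙-no (v ≟ _) (lookup v∉vs u∈vs)))) ⟩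
    1 * h v + 0
      ≡⟨ trans (+-identityʳ (1 * h v)) (*-identityˡ (h v)) ⟩
    h v ∎
    where open ≡-Reasoning
  ∑-δ h {y} (v ∷ vs) (v∉vs ∷ unique) (there y∈vs) = begin
    𝟙 (y ≟ v) * h v + ∑[ u ∈ vs ] (𝟙 (y ≟ u) * h u)
      ≡⟨ cong (λ n → n * h v + _) (𝟙-no (y ≟ v) (≢-sym (lookup v∉vs y∈vs))) ⟩
    ∑[ u ∈ vs ] (𝟙 (y ≟ u) * h u)
      ≡⟨ ∑-δ h vs unique y∈vs ⟩
    h y ∎
    where open ≡-Reasoning

  ∑-fibres : ∀ (e : A → B) (h : B → ℕ) xs ys → Unique ys → (∀ {x} → x ∈ xs → e x ∈ ys) →
             ∑[ x ∈ xs ] h (e x) ≡ ∑[ v ∈ ys ] (∑[ x ∈ xs ] 𝟙 (e x ≟ v) * h v)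
  ∑-fibres e h xs ys unique e∈ys = begin
    ∑[ x ∈ xs ] h (e x)
      ≡⟨ ∑-cong xs (λ x∈xs → sym (∑-δ h ys unique (e∈ys x∈xs))) ⟩
    ∑[ x ∈ xs ] ∑[ v ∈ ys ] (𝟙 (e x ≟ v) * h v)
      ≡⟨ ∑-comm (λ x v → 𝟙 (e x ≟ v) * h v) xs ys ⟩
    ∑[ v ∈ ys ] ∑[ x ∈ xs ] (𝟙 (e x ≟ v) * h v)
      ≡⟨ ∑-cong ys (λ {v} _ → sym (∑-distribʳ-* (h v) (λ x → 𝟙 (e x ≟ v)) xs)) ⟩
    ∑[ v ∈ ys ] (∑[ x ∈ xs ] 𝟙 (e x ≟ v) * h v) ∎
    where open ≡-Reasoning

  ∑-injective-≤ : ∀ (e : A → B) (h : B → ℕ) xs ys → Unique xs → Unique ys →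
                  (∀ {x} → x ∈ xs → e x ∈ ys) →
                  (∀ {x x′} → x ∈ xs → x′ ∈ xs → e x ≡ e x′ → x ≡ x′) →
                  ∑[ x ∈ xs ] h (e x) ≤ ∑ ys h
  ∑-injective-≤ e h xs ys unique-xs unique-ys e∈ys injective = begin
    ∑[ x ∈ xs ] h (e x)
      ≡⟨ ∑-fibres e h xs ys unique-ys e∈ys ⟩
    ∑[ v ∈ ys ] (∑[ x ∈ xs ] 𝟙 (e x ≟ v) * h v)
      ≤⟨ ∑-mono-≤ ys (λ {v} _ → *-monoˡ-≤ (h v) (fibre≤1 xs unique-xs injective)) ⟩
    ∑[ v ∈ ys ] (1 * h v)
      ≡⟨ ∑-cong ys (λ {v} _ → *-identityˡ (h v)) ⟩
    ∑ ys h ∎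
    where
    open ≤-Reasoning
    fibre≤1 : ∀ {v} xs → Unique xs → (∀ {x x′} → x ∈ xs → x′ ∈ xs → e x ≡ e x′ → x ≡ x′) →
              ∑[ x ∈ xs ] 𝟙 (e x ≟ v) ≤ 1
    fibre≤1 []       _                 _   = z≤n
    fibre≤1 {v} (x ∷ xs) (x∉xs ∷ unique) inj with e x ≟ v
    ... | no  _    = fibre≤1 xs unique (λ x∈ x′∈ → inj (there x∈) (there x′∈))
    ... | yes ex≡v = ≤-reflexive (cong suc (∑-zero xs (λ x′∈xs → 𝟙-no (_ ≟ v) (λ ex′≡v →
          lookup x∉xs x′∈xs (inj (here refl) (there x′∈xs) (trans ex≡v (sym ex′≡v)))))))

-- Collisions and the number of values of a function on a list

6*n≤9+n*n : ∀ n → 6 * n ≤ 9 + n * n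
6*n≤9+n*n 0 = z≤n
6*n≤9+n*n 1 = m≤m+n 6 4
6*n≤9+n*n 2 = m≤m+n 12 1
6*n≤9+n*n (suc (suc (suc m))) =
  subst (6 * (3 + m) ≤_) (sym (square-expansion m)) (m≤m+n (6 * (3 + m)) (m * m))
  where
  square-expansion : ∀ m → 9 + (3 + m) * (3 + m) ≡ 6 * (3 + m) + m * m
  square-expansion = solve-∀

module _ {A B : Set} (_≟_ : DecidableEquality B) where

  collisions : (A → B) → List A → ℕ
  collisions f xs = ∑[ x ∈ xs ] ∑[ y ∈ xs ] 𝟙 (f y ≟ f x)

  6*length≤9*values+collisions : ∀ f xs →
    6 * length xs ≤ 9 * length (deduplicate _≟_ (map f xs)) + collisions f xs
  6*length≤9*values+collisions f xs = begin
    6 * length xs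
      ≡⟨ cong (6 *_) (trans (sym (*-identityʳ (length xs))) (sym (∑-const 1 xs))) ⟩
    6 * ∑[ x ∈ xs ] 1
      ≡⟨ cong (6 *_) (∑-fibres _≟_ f (λ _ → 1) xs values unique f∈values) ⟩
    6 * ∑[ v ∈ values ] (size v * 1)
      ≡⟨ ∑-distribˡ-* 6 (λ v → size v * 1) values ⟩
    ∑[ v ∈ values ] (6 * (size v * 1))
      ≤⟨ ∑-mono-≤ values (λ {v} _ → subst (λ n → 6 * n ≤ 9 + size v * size v)
                                          (sym (*-identityʳ (size v))) (6*n≤9+n*n (size v))) ⟩
    ∑[ v ∈ values ] (9 + size v * size v)
      ≡⟨ ∑-distrib-+ (λ _ → 9) (λ v → size v * size v) values ⟩
    ∑[ v ∈ values ] 9 + ∑[ v ∈ values ] (size v * size v)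
      ≡⟨ cong₂ _+_ (trans (∑-const 9 values) (*-comm (length values) 9))
                   (sym (∑-fibres _≟_ f size xs values unique f∈values)) ⟩
    9 * length values + collisions f xs ∎
    where
    open ≤-Reasoning
    values = deduplicate _≟_ (map f xs)
    size : B → ℕ
    size v = ∑[ x ∈ xs ] 𝟙 (f x ≟ v)
    unique : Unique values
    unique = deduplicate-! _≟_ (map f xs)
    f∈values : ∀ {x} → x ∈ xs → f x ∈ values
    f∈values x∈xs = ∈-deduplicate⁺ _≟_ (∈-map⁺ f x∈xs)

  few-collisions⇒many-values : ∀ f xs → collisions f xs < 3 * length xs →
                               length xs < 3 * length (deduplicate _≟_ (map f xs))
  few-collisions⇒many-values f xs few =
    *-cancelˡ-< 3 (length xs) (3 * V) (+-cancelʳ-< (3 * length xs) _ _ (begin-strict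
      3 * length xs + 3 * length xs  ≡⟨ 3n+3n≡6n (length xs) ⟩
      6 * length xs                  ≤⟨ 6*length≤9*values+collisions f xs ⟩
      9 * V + collisions f xs        <⟨ +-monoʳ-< (9 * V) few ⟩
      9 * V + 3 * length xs          ≡⟨ cong (_+ 3 * length xs) (*-assoc 3 3 V) ⟩
      3 * (3 * V) + 3 * length xs    ∎))
    where
    open ≤-Reasoning
    V = length (deduplicate _≟_ (map f xs))
    3n+3n≡6n : ∀ n → 3 * n + 3 * n ≡ 6 * n
    3n+3n≡6n = solve-∀

module _ (n : ℕ) .{{_ : NonZero n}} where

  /ℕ-unique : ∀ {a k} → k ℤ.* + n ℤ.≤ a → a ℤ.< ℤ.suc k ℤ.* + n → a /ℕ n ≡ k
  /ℕ-unique {a} {k} k*n≤a a<[k+1]*n = ℤ.≤-antisym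
    (<-suc⇒≤ (ℤ.*-cancelʳ-<-nonNeg (+ n) (ℤ.≤-<-trans ([n/ℕd]*d≤n a n) a<[k+1]*n)))
    (<-suc⇒≤ (ℤ.*-cancelʳ-<-nonNeg (+ n) (ℤ.≤-<-trans k*n≤a (n<s[n/ℕd]*d a n))))
    where
    <-suc⇒≤ : ∀ {i j} → i ℤ.< ℤ.suc j → i ℤ.≤ j
    <-suc⇒≤ {j = j} i<j+1 = subst (_ ℤ.≤_) (ℤ.pred-suc j) (ℤ.i<j⇒i≤pred[j] i<j+1)

  %ℕ-unique : ∀ {a k r} → r < n → a ≡ + r ℤ.+ k ℤ.* + n → a %ℕ n ≡ r
  %ℕ-unique {a} {k} {r} r<n refl = ℤ.+-injective (∙-cancelʳ (k ℤ.* + n) _ _ (begin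
    + (a %ℕ n) ℤ.+ k ℤ.* + n         ≡⟨ cong (λ m → + (a %ℕ n) ℤ.+ m ℤ.* + n) quotient ⟨
    + (a %ℕ n) ℤ.+ a /ℕ n ℤ.* + n    ≡⟨ a≡a%ℕn+[a/ℕn]*n a n ⟨
    a                                ∎))
    where
    open ≡-Reasoning
    quotient : a /ℕ n ≡ k
    quotient = /ℕ-unique (ℤ.i≤j+i (k ℤ.* + n) (+ r))
      (subst (a ℤ.<_) (sym (ℤ.suc-* k (+ n))) (ℤ.+-monoˡ-< (k ℤ.* + n) (+<+ r<n)))

  %ℕ-distrib-∸ : ∀ a b → b %ℕ n ≤ a %ℕ n → (a ℤ.- b) %ℕ n ≡ a %ℕ n ∸ b %ℕ n
  %ℕ-distrib-∸ a b rb≤ra = %ℕ-unique {k = qa ℤ.- qb} (≤-<-trans (m∸n≤m ra rb) (n%ℕd<d a n)) (begin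
    a ℤ.- b
      ≡⟨ cong₂ ℤ._-_ (a≡a%ℕn+[a/ℕn]*n a n) (a≡a%ℕn+[a/ℕn]*n b n) ⟩
    (+ ra ℤ.+ qa ℤ.* + n) ℤ.- (+ rb ℤ.+ qb ℤ.* + n)
      ≡⟨ regroup (+ ra) (+ rb) qa qb (+ n) ⟩
    (+ ra ℤ.- + rb) ℤ.+ (qa ℤ.- qb) ℤ.* + n
      ≡⟨ cong (ℤ._+ (qa ℤ.- qb) ℤ.* + n) (trans (ℤ.[+m]-[+n]≡m⊖n ra rb) (ℤ.⊖-≥ rb≤ra)) ⟩
    + (ra ∸ rb) ℤ.+ (qa ℤ.- qb) ℤ.* + n ∎)
    where
    open ≡-Reasoning
    ra = a %ℕ n
    rb = b %ℕ n
    qa = a /ℕ n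
    qb = b /ℕ n
    regroup : ∀ r s k l m → (r ℤ.+ k ℤ.* m) ℤ.- (s ℤ.+ l ℤ.* m) ≡ (r ℤ.- s) ℤ.+ (k ℤ.- l) ℤ.* m
    regroup = ℤ-solve-∀

  %ℕ-≡⇒∣- : ∀ a b → a %ℕ n ≡ b %ℕ n → + n ∣ℤ (a ℤ.- b)
  %ℕ-≡⇒∣- a b ra≡rb = divides ℤ.∣ qa ℤ.- qb ∣ (begin
    ℤ.∣ a ℤ.- b ∣
      ≡⟨ cong₂ (λ x y → ℤ.∣ x ℤ.- y ∣) (a≡a%ℕn+[a/ℕn]*n a n) (a≡a%ℕn+[a/ℕn]*n b n) ⟩
    ℤ.∣ (+ ra ℤ.+ qa ℤ.* + n) ℤ.- (+ (b %ℕ n) ℤ.+ qb ℤ.* + n) ∣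
      ≡⟨ cong (λ r → ℤ.∣ (+ ra ℤ.+ qa ℤ.* + n) ℤ.- (+ r ℤ.+ qb ℤ.* + n) ∣) ra≡rb ⟨
    ℤ.∣ (+ ra ℤ.+ qa ℤ.* + n) ℤ.- (+ ra ℤ.+ qb ℤ.* + n) ∣
      ≡⟨ cong ℤ.∣_∣ (cancel (+ ra) qa qb (+ n)) ⟩
    ℤ.∣ (qa ℤ.- qb) ℤ.* + n ∣
      ≡⟨ ℤ.abs-* (qa ℤ.- qb) (+ n) ⟩
    ℤ.∣ qa ℤ.- qb ∣ * n ∎)
    where
    open ≡-Reasoning
    ra = a %ℕ n
    qa = a /ℕ n
    qb = b /ℕ n
    cancel : ∀ r k l m → (r ℤ.+ k ℤ.* m) ℤ.- (r ℤ.+ l ℤ.* m) ≡ (k ℤ.- l) ℤ.* m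
    cancel = ℤ-solve-∀

  *-%ℕ-injective : ∀ d → Coprime (+ n) d → ∀ {i j} → i < n → j < n →
                   (+ i ℤ.* d) %ℕ n ≡ (+ j ℤ.* d) %ℕ n → i ≡ j
  *-%ℕ-injective d coprime {i} {j} i<n j<n ≡-mod-n =
    ℤ.+-injective (ℤ.i-j≡0⇒i≡j (+ i) (+ j) (ℤ.∣i∣≡0⇒i≡0 ∣i-j∣≡0))
    where
    n∣d*[i-j] : + n ∣ℤ (d ℤ.* (+ i ℤ.- + j))
    n∣d*[i-j] = subst (+ n ∣ℤ_) (factor d (+ i) (+ j)) (%ℕ-≡⇒∣- (+ i ℤ.* d) (+ j ℤ.* d) ≡-mod-n)
      where
      factor : ∀ d i j → i ℤ.* d ℤ.- j ℤ.* d ≡ d ℤ.* (i ℤ.- j)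
      factor = ℤ-solve-∀
    ∣i-j∣<n : ℤ.∣ + i ℤ.- + j ∣ < n
    ∣i-j∣<n = subst (_< n) (cong ℤ.∣_∣ (sym (ℤ.[+m]-[+n]≡m⊖n i j)))
                (≤-<-trans (ℤ.∣m⊝n∣≤m⊔n i j) (⊔-lub i<n j<n))
    multiple-below-n : ∀ {m} → n ∣ m → m < n → m ≡ 0
    multiple-below-n {zero}  _   _   = refl
    multiple-below-n {suc m} n∣m m<n = contradiction n∣m (>⇒∤ m<n)
    ∣i-j∣≡0 : ℤ.∣ + i ℤ.- + j ∣ ≡ 0
    ∣i-j∣≡0 = multiple-below-n (coprime-divisor (+ n) d (+ i ℤ.- + j) coprime n∣d*[i-j]) ∣i-j∣<n

/ℕ-cong-≃ : ∀ {a b n d} .{{_ : NonZero n}} .{{_ : NonZero d}} →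
            a ℤ.* + d ≡ b ℤ.* + n → a /ℕ n ≡ b /ℕ d
/ℕ-cong-≃ {a} {b} {n@(suc _)} {d@(suc _)} a*d≡b*n = /ℕ-unique n
  (ℤ.*-cancelʳ-≤-pos (k ℤ.* + n) a (+ d) (begin
    k ℤ.* + n ℤ.* + d         ≡⟨ *-right-comm k (+ n) (+ d) ⟩
    k ℤ.* + d ℤ.* + n         ≤⟨ ℤ.*-monoʳ-≤-nonNeg (+ n) ([n/ℕd]*d≤n b d) ⟩
    b ℤ.* + n                 ≡⟨ a*d≡b*n ⟨
    a ℤ.* + d                 ∎))
  (ℤ.*-cancelʳ-<-nonNeg (+ d) (begin-strict
    a ℤ.* + d                 ≡⟨ a*d≡b*n ⟩
    b ℤ.* + n                 <⟨ ℤ.*-monoʳ-<-pos (+ n) (n<s[n/ℕd]*d b d) ⟩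
    ℤ.suc k ℤ.* + d ℤ.* + n   ≡⟨ *-right-comm (ℤ.suc k) (+ d) (+ n) ⟩
    ℤ.suc k ℤ.* + n ℤ.* + d   ∎))
  where
  open ℤ.≤-Reasoning
  k = b /ℕ d
  *-right-comm : ∀ x y z → x ℤ.* y ℤ.* z ≡ x ℤ.* z ℤ.* y
  *-right-comm = ℤ-solve-∀

m/n≡o/n⇒m∸o<n : ∀ m o n .{{_ : NonZero n}} → m ℕ./ n ≡ o ℕ./ n → m ∸ o < n
m/n≡o/n⇒m∸o<n m o n m/n≡o/n = begin-strict
  m ∸ o
    ≡⟨ cong₂ _∸_ (split m) (trans (cong (λ k → k * n + o ℕ.% n) m/n≡o/n) (split o)) ⟨
  (m ℕ./ n * n + m ℕ.% n) ∸ (m ℕ./ n * n + o ℕ.% n)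
    ≡⟨ [m+n]∸[m+o]≡n∸o (m ℕ./ n * n) (m ℕ.% n) (o ℕ.% n) ⟩
  m ℕ.% n ∸ o ℕ.% n
    ≤⟨ m∸n≤m (m ℕ.% n) (o ℕ.% n) ⟩
  m ℕ.% n
    <⟨ m%n<n m n ⟩
  n ∎
  where
  open ≤-Reasoning
  split : ∀ k → k ℕ./ n * n + k ℕ.% n ≡ k
  split k = trans (+-comm (k ℕ./ n * n) (k ℕ.% n)) (sym (m≡m%n+[m/n]*n k n))

coprime-suc : ∀ {m d} → d ∣ m → ℕ.Coprime (suc m) d
coprime-suc {m} d∣m {i} (i∣1+m , i∣d) =
  ∣1⇒≡1 (∣m+n∣m⇒∣n (subst (i ∣_) (+-comm 1 m) i∣1+m) (∣-trans i∣d d∣m))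

∣! : ∀ {d m} → 0 < d → d ≤ m → d ∣ m !
∣! {suc d} _ d≤m = ∣-trans (m∣m*n (d !)) (m≤n⇒m!∣n! d≤m)

-- Rationals given as a / n with n not necessarily in lowest terms

toℚᵘ-/ : ∀ i m → toℚᵘ (i / suc m) ≃ i /ᵘ suc m
toℚᵘ-/ i m = toℚᵘ-fromℚᵘ (i /ᵘ suc m)

/ᵘ-cong : ∀ {a b n d} .{{_ : NonZero n}} .{{_ : NonZero d}} → a ℤ.* + d ≡ b ℤ.* + n → a /ᵘ n ≃ b /ᵘ d
/ᵘ-cong {n = suc _} {d = suc _} = *≡*

floor-≃ : ∀ p a n .{{_ : NonZero n}} → toℚᵘ p ≃ a /ᵘ n → floor p ≡ a /ℕ n
floor-≃ (mkℚ b d-1 _) a (suc m) (*≡* b*n≡a*d) =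
  trans (div-pos-is-/ℕ b (suc d-1)) (/ℕ-cong-≃ {b} {a} {suc d-1} {suc m} b*n≡a*d)

/ᵘ-minus-/ℕ : ∀ a m → a /ᵘ suc m ℚᵘ.- (a /ℕ suc m) /ᵘ 1 ≃ + (a %ℕ suc m) /ᵘ suc m
/ᵘ-minus-/ℕ a m = /ᵘ-cong (begin
  (a ℤ.* + 1 ℤ.+ ℤ.- k ℤ.* + n) ℤ.* + n
    ≡⟨ cong (λ x → (x ℤ.* + 1 ℤ.+ ℤ.- k ℤ.* + n) ℤ.* + n) (a≡a%ℕn+[a/ℕn]*n a n) ⟩
  ((+ r ℤ.+ k ℤ.* + n) ℤ.* + 1 ℤ.+ ℤ.- k ℤ.* + n) ℤ.* + n
    ≡⟨ cancel (+ r) k (+ n) ⟩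
  + r ℤ.* + n
    ≡⟨ cong (λ x → + r ℤ.* + x) (*-identityʳ n) ⟨
  + r ℤ.* + (n * 1) ∎)
  where
  open ≡-Reasoning
  n = suc m
  k = a /ℕ n
  r = a %ℕ n
  cancel : ∀ r k n → ((r ℤ.+ k ℤ.* n) ℤ.* + 1 ℤ.+ ℤ.- k ℤ.* n) ℤ.* n ≡ r ℤ.* n
  cancel = ℤ-solve-∀

frac-≃ : ∀ p a m → toℚᵘ p ≃ a /ᵘ suc m → toℚᵘ (frac p) ≃ + (a %ℕ suc m) /ᵘ suc m
frac-≃ p a m p≃a/n = begin
  toℚᵘ (p ℚ.- ι (floor p))
    ≡⟨ cong (λ k → toℚᵘ (p ℚ.- ι k)) (floor-≃ p a (suc m) p≃a/n) ⟩
  toℚᵘ (p ℚ.- ι k)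
    ≈⟨ toℚᵘ-homo-+ p (ℚ.- ι k) ⟩
  toℚᵘ p ℚᵘ.+ toℚᵘ (ℚ.- ι k)
    ≈⟨ ℚᵘ.+-cong p≃a/n (≃-trans (toℚᵘ-homo‿- (ι k)) (ℚᵘ.-‿cong (toℚᵘ-/ k 0))) ⟩
  a /ᵘ suc m ℚᵘ.- k /ᵘ 1
    ≈⟨ /ᵘ-minus-/ℕ a m ⟩
  + (a %ℕ suc m) /ᵘ suc m ∎
  where
  open ℚᵘ.≃-Reasoning
  k = a /ℕ suc m

π-/ : ∀ q m j n → π q (+ j / suc m) n ≡ + ((q * ((+ j ℤ.* n) %ℕ suc m)) ℕ./ suc m)
π-/ q m j n = floor-≃ (ι (+ q) ℚ.* frac x) (+ (q * r)) (suc m) (begin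
  toℚᵘ (ι (+ q) ℚ.* frac x)
    ≈⟨ toℚᵘ-homo-* (ι (+ q)) (frac x) ⟩
  toℚᵘ (ι (+ q)) ℚᵘ.* toℚᵘ (frac x)
    ≈⟨ ℚᵘ.*-cong (toℚᵘ-/ (+ q) 0) (frac-≃ x (+ j ℤ.* n) m x≃jn/n) ⟩
  (+ q /ᵘ 1) ℚᵘ.* (+ r /ᵘ suc m)
    ≈⟨ /ᵘ-cong (cong₂ ℤ._*_ (sym (ℤ.pos-* q r)) (cong +_ (sym (*-identityˡ (suc m))))) ⟩
  + (q * r) /ᵘ suc m ∎)
  where
  open ℚᵘ.≃-Reasoning
  x = (+ j / suc m) ℚ.* ι n
  r = (+ j ℤ.* n) %ℕ suc m
  x≃jn/n : toℚᵘ x ≃ (+ j ℤ.* n) /ᵘ suc m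
  x≃jn/n = begin
    toℚᵘ x
      ≈⟨ toℚᵘ-homo-* (+ j / suc m) (ι n) ⟩
    toℚᵘ (+ j / suc m) ℚᵘ.* toℚᵘ (ι n)
      ≈⟨ ℚᵘ.*-cong (toℚᵘ-/ (+ j) m) (toℚᵘ-/ n 0) ⟩
    (+ j /ᵘ suc m) ℚᵘ.* (n /ᵘ 1)
      ≈⟨ /ᵘ-cong (cong (λ d → (+ j ℤ.* n) ℤ.* + d) (sym (*-identityʳ (suc m)))) ⟩
    (+ j ℤ.* n) /ᵘ suc m ∎

0<j/[1+m] : ∀ j m → 0 < j → 0ℚ <ℚ + j / suc m
0<j/[1+m] j m 0<j = toℚᵘ-cancel-< (<-respʳ-≃ (≃-sym (toℚᵘ-/ (+ j) m))
  (*<* (subst₂ ℤ._<_ (sym (ℤ.*-zeroˡ (+ suc m))) (sym (ℤ.*-identityʳ (+ j))) (+<+ 0<j))))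

j/[1+m]<1 : ∀ j m → j < suc m → + j / suc m <ℚ 1ℚ
j/[1+m]<1 j m j<n = toℚᵘ-cancel-< (<-respˡ-≃ (≃-sym (toℚᵘ-/ (+ j) m))
  (*<* (subst₂ ℤ._<_ (sym (ℤ.*-identityʳ (+ j))) (sym (ℤ.*-identityˡ (+ suc m))) (+<+ j<n))))

-- Averaging over the parameters t = j / (M + 1), 1 ≤ j ≤ M

oneTo : ℕ → List ℕ
oneTo = applyDownFrom suc

∈-oneTo⁺ : ∀ {M j} → 0 < j → j ≤ M → j ∈ oneTo M
∈-oneTo⁺ {j = suc i} _ i<M = ∈-applyDownFrom⁺ suc i<M

∈-oneTo⁻ : ∀ {M j} → j ∈ oneTo M → 0 < j × j ≤ M
∈-oneTo⁻ j∈ with ∈-applyDownFrom⁻ suc j∈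
... | i , i<M , refl = s≤s z≤n , i<M

oneTo-unique : ∀ M → Unique (oneTo M)
oneTo-unique M = applyDownFrom⁺₁ suc M (λ j<i _ → <⇒≢ j<i ∘′ sym ∘′ suc-injective)

length-oneTo : ∀ M → length (oneTo M) ≡ M
length-oneTo = length-applyDownFrom suc

q*#small≤M : ∀ q M K → q * ∑[ r ∈ oneTo K ] 𝟙 (q * r ≤? M) ≤ M
q*#small≤M q M zero    = ≤-trans (≤-reflexive (*-zeroʳ q)) z≤n
q*#small≤M q M (suc K) with q * suc K ≤? M
... | no  _        = q*#small≤M q M K
... | yes q[K+1]≤M = begin
  q * (1 + ∑[ r ∈ oneTo K ] 𝟙 (q * r ≤? M))  ≤⟨ *-monoʳ-≤ q (s≤s #≤K) ⟩
  q * suc K                                  ≤⟨ q[K+1]≤M ⟩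
  M                                          ∎
  where
  open ≤-Reasoning
  #≤K : ∑[ r ∈ oneTo K ] 𝟙 (q * r ≤? M) ≤ K
  #≤K = ≤-trans (∑-bound 1 (oneTo K) (λ {r} _ → 𝟙≤1 (q * r ≤? M)))
                (≤-reflexive (trans (*-identityʳ (length (oneTo K))) (length-oneTo K)))

module _ (q : ℕ) .{{_ : NonZero q}} (M : ℕ) where

  residue : ℕ → ℤ → ℕ
  residue j d = (+ j ℤ.* d) %ℕ suc M

  πⱼ : ℕ → ℤ → ℤ
  πⱼ j = π q (+ j / suc M)

  equal-quotients⇒small-residue : ∀ j x y → residue j y ≤ residue j x →
    (q * residue j x) ℕ./ suc M ≡ (q * residue j y) ℕ./ suc M → q * residue j (x ℤ.- y) ≤ M
  equal-quotients⇒small-residue j x y Ry≤Rx same-quotient = s≤s⁻¹ (begin-strict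
    q * residue j (x ℤ.- y)
      ≡⟨ cong (λ a → q * (a %ℕ suc M)) (distrib (+ j) x y) ⟩
    q * ((+ j ℤ.* x ℤ.- + j ℤ.* y) %ℕ suc M)
      ≡⟨ cong (q *_) (%ℕ-distrib-∸ (suc M) (+ j ℤ.* x) (+ j ℤ.* y) Ry≤Rx) ⟩
    q * (residue j x ∸ residue j y)
      ≡⟨ *-distribˡ-∸ q (residue j x) (residue j y) ⟩
    q * residue j x ∸ q * residue j y
      <⟨ m/n≡o/n⇒m∸o<n (q * residue j x) (q * residue j y) (suc M) same-quotient ⟩
    suc M ∎)
    where
    open ≤-Reasoning
    distrib : ∀ a x y → a ℤ.* (x ℤ.- y) ≡ a ℤ.* x ℤ.- a ℤ.* y
    distrib = ℤ-solve-∀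

  collision⇒equal-quotients : ∀ j x y → πⱼ j y ≡ πⱼ j x →
                              (q * residue j y) ℕ./ suc M ≡ (q * residue j x) ℕ./ suc M
  collision⇒equal-quotients j x y πy≡πx =
    ℤ.+-injective (trans (sym (π-/ q M j y)) (trans πy≡πx (π-/ q M j x)))

  collision⇒small-residue : ∀ j x y → πⱼ j y ≡ πⱼ j x →
                            q * residue j (x ℤ.- y) ≤ M ⊎ q * residue j (y ℤ.- x) ≤ M
  collision⇒small-residue j x y πy≡πx with ≤-total (residue j y) (residue j x)
  ... | inj₁ Ry≤Rx =
    inj₁ (equal-quotients⇒small-residue j x y Ry≤Rx (sym (collision⇒equal-quotients j x y πy≡πx)))
  ... | inj₂ Rx≤Ry =
    inj₂ (equal-quotients⇒small-residue j y x Rx≤Ry (collision⇒equal-quotients j x y πy≡πx))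

  residue-∈-oneTo : ∀ d → Coprime (+ suc M) d → ∀ {j} → j ∈ oneTo M → residue j d ∈ oneTo M
  residue-∈-oneTo d coprime {j} j∈ with ∈-oneTo⁻ j∈
  ... | 0<j , j≤M = ∈-oneTo⁺ (n≢0⇒n>0 residue≢0) (s≤s⁻¹ (n%ℕd<d (+ j ℤ.* d) (suc M)))
    where
    -- residue 0 d reduces to 0, so injectivity forces j ≡ 0.
    residue≢0 : residue j d ≢ 0
    residue≢0 r≡0 = <⇒≢ 0<j (sym (*-%ℕ-injective (suc M) d coprime (s≤s j≤M) (s≤s z≤n) r≡0))

  residue-injective : ∀ d → Coprime (+ suc M) d → ∀ {i j} → i ∈ oneTo M → j ∈ oneTo M →
                      residue i d ≡ residue j d → i ≡ j
  residue-injective d coprime i∈ j∈ =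
    *-%ℕ-injective (suc M) d coprime (s≤s (proj₂ (∈-oneTo⁻ i∈))) (s≤s (proj₂ (∈-oneTo⁻ j∈)))

  q*#small-residues≤M : ∀ d → Coprime (+ suc M) d →
                        q * ∑[ j ∈ oneTo M ] 𝟙 (q * residue j d ≤? M) ≤ M
  q*#small-residues≤M d coprime = ≤-trans
    (*-monoʳ-≤ q (∑-injective-≤ ℕ._≟_ (λ j → residue j d) (λ r → 𝟙 (q * r ≤? M))
      (oneTo M) (oneTo M) (oneTo-unique M) (oneTo-unique M)
      (residue-∈-oneTo d coprime) (residue-injective d coprime)))
    (q*#small≤M q M M)

  agreements : ℤ → ℤ → ℕ
  agreements x y = ∑[ j ∈ oneTo M ] 𝟙 (πⱼ j y ≟ℤ πⱼ j x)

  agreements≤M : ∀ x y → agreements x y ≤ M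
  agreements≤M x y = ≤-trans (∑-bound 1 (oneTo M) (λ {j} _ → 𝟙≤1 (πⱼ j y ≟ℤ πⱼ j x)))
                             (≤-reflexive (trans (*-identityʳ (length (oneTo M))) (length-oneTo M)))

  q*agreements≤2M : ∀ x y → Coprime (+ suc M) (x ℤ.- y) → Coprime (+ suc M) (y ℤ.- x) →
                    q * agreements x y ≤ M + M
  q*agreements≤2M x y coprime coprime′ = begin
    q * agreements x y
      ≤⟨ *-monoʳ-≤ q (∑-mono-≤ (oneTo M) (λ {j} _ → agreement⇒small j)) ⟩
    q * ∑[ j ∈ oneTo M ] (small j (x ℤ.- y) + small j (y ℤ.- x))
      ≡⟨ cong (q *_) (∑-distrib-+ (λ j → small j (x ℤ.- y)) (λ j → small j (y ℤ.- x)) (oneTo M)) ⟩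
    q * (#small (x ℤ.- y) + #small (y ℤ.- x))
      ≡⟨ *-distribˡ-+ q (#small (x ℤ.- y)) (#small (y ℤ.- x)) ⟩
    q * #small (x ℤ.- y) + q * #small (y ℤ.- x)
      ≤⟨ +-mono-≤ (q*#small-residues≤M (x ℤ.- y) coprime) (q*#small-residues≤M (y ℤ.- x) coprime′) ⟩
    M + M ∎
    where
    open ≤-Reasoning
    small : ℕ → ℤ → ℕ
    small j d = 𝟙 (q * residue j d ≤? M)
    #small : ℤ → ℕ
    #small d = ∑[ j ∈ oneTo M ] small j d
    agreement⇒small : ∀ j → 𝟙 (πⱼ j y ≟ℤ πⱼ j x) ≤ small j (x ℤ.- y) + small j (y ℤ.- x)
    agreement⇒small j with πⱼ j y ≟ℤ πⱼ j x
    ... | no _ = z≤n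
    ... | yes πy≡πx with collision⇒small-residue j x y πy≡πx
    ...   | inj₁ h = ≤-trans (≤-reflexive (sym (𝟙-yes (q * residue j (x ℤ.- y) ≤? M) h))) (m≤m+n _ _)
    ...   | inj₂ h = ≤-trans (≤-reflexive (sym (𝟙-yes (q * residue j (y ℤ.- x) ≤? M) h))) (m≤n+m _ _)

DifferencesCoprimeTo : ℕ → List ℤ → Set
DifferencesCoprimeTo n S = ∀ {x y} → x ∈ S → y ∈ S → x ≢ y → Coprime (+ n) (x ℤ.- y)

module _ (q : ℕ) .{{_ : NonZero q}} (M : ℕ) (0<M : 0 < M)
         (S : List ℤ) (unique : Unique S) (|S|≡q : length S ≡ q)
         (coprime : DifferencesCoprimeTo (suc M) S) where

  ∑agreements<3M : ∀ {x} → x ∈ S → ∑[ y ∈ S ] agreements q M x y < 3 * M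
  ∑agreements<3M {x} x∈S = *-cancelˡ-< q _ _ (begin-strict
    q * ∑[ y ∈ S ] agreements q M x y              ≡⟨ ∑-distribˡ-* q (agreements q M x) S ⟩
    ∑[ y ∈ S ] (q * agreements q M x y)            <⟨ m<m+n _ (≤-trans 0<M (m≤m+n M M)) ⟩
    ∑[ y ∈ S ] (q * agreements q M x y) + (M + M)  ≤⟨ ∑-≤-except (q * M) (M + M) S unique x∈S
                                                        (*-monoʳ-≤ q (agreements≤M q M x x)) off-diagonal ⟩
    q * M + length S * (M + M)                     ≡⟨ cong (λ n → q * M + n * (M + M)) |S|≡q ⟩
    q * M + q * (M + M)                            ≡⟨ factor q M ⟩
    q * (3 * M)                                    ∎)
    where
    open ≤-Reasoning
    off-diagonal : ∀ {y} → y ∈ S → y ≢ x → q * agreements q M x y ≤ M + M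
    off-diagonal {y} y∈S y≢x =
      q*agreements≤2M q M x y (coprime x∈S y∈S (≢-sym y≢x)) (coprime y∈S x∈S y≢x)
    factor : ∀ q M → q * M + q * (M + M) ≡ q * (3 * M)
    factor = solve-∀

  ∃-few-collisions : ∃ λ j → j ∈ oneTo M × collisions _≟ℤ_ (πⱼ q M j) S < 3 * q
  ∃-few-collisions = ∑<⇒∃< (3 * q) (oneTo M) (begin-strict
    ∑[ j ∈ oneTo M ] collisions _≟ℤ_ (πⱼ q M j) S  ≡⟨ double-count ⟩
    ∑[ x ∈ S ] ∑[ y ∈ S ] agreements q M x y       <⟨ ∑-bound-< (3 * M) S 0<|S| ∑agreements<3M ⟩
    length S * (3 * M)                             ≡⟨ cong (_* (3 * M)) |S|≡q ⟩
    q * (3 * M)                                    ≡⟨ swap q M ⟩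
    M * (3 * q)                                    ≡⟨ cong (_* (3 * q)) (length-oneTo M) ⟨
    length (oneTo M) * (3 * q)                     ∎)
    where
    open ≤-Reasoning
    0<|S| : 0 < length S
    0<|S| = subst (0 <_) (sym |S|≡q) (>-nonZero⁻¹ q)
    swap : ∀ q M → q * (3 * M) ≡ M * (3 * q)
    swap = solve-∀
    agree : ℕ → ℤ → ℤ → ℕ
    agree j x y = 𝟙 (πⱼ q M j y ≟ℤ πⱼ q M j x)
    double-count : ∑[ j ∈ oneTo M ] collisions _≟ℤ_ (πⱼ q M j) S ≡
                   ∑[ x ∈ S ] ∑[ y ∈ S ] agreements q M x y
    double-count = trans (∑-comm (λ j x → ∑[ y ∈ S ] agree j x y) (oneTo M) S)
                         (∑-cong S (λ {x} _ → ∑-comm (λ j y → agree j x y) (oneTo M) S))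

differences-coprime : ∀ S → DifferencesCoprimeTo (suc ((∑ S ℤ.∣_∣ + ∑ S ℤ.∣_∣) !)) S
differences-coprime S {x} {y} x∈S y∈S x≢y = coprime-suc (∣! 0<∣x-y∣ ∣x-y∣≤2B)
  where
  0<∣x-y∣ : 0 < ℤ.∣ x ℤ.- y ∣
  0<∣x-y∣ = n≢0⇒n>0 (λ ∣x-y∣≡0 → x≢y (ℤ.i-j≡0⇒i≡j x y (ℤ.∣i∣≡0⇒i≡0 ∣x-y∣≡0)))
  ∣x-y∣≤2B : ℤ.∣ x ℤ.- y ∣ ≤ ∑ S ℤ.∣_∣ + ∑ S ℤ.∣_∣
  ∣x-y∣≤2B = ≤-trans (ℤ.∣i-j∣≤∣i∣+∣j∣ x y) (+-mono-≤ (∈⇒≤∑ ℤ.∣_∣ x∈S) (∈⇒≤∑ ℤ.∣_∣ y∈S))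

lemma6 : (q : ℕ) → .{{_ : NonZero q}} → (S : List ℤ) → Unique S → length S ≡ q →
         ∃ λ (t : ℚ) → (0ℚ <ℚ t) × (t <ℚ 1ℚ) ×
           (q < 3 * length (deduplicate _≟ℤ_ (map (π q t) S)))
lemma6 _ S unique refl =
  let j , j∈ , few = ∃-few-collisions (length S) M (1≤n! (B + B)) S unique refl (differences-coprime S)
      0<j , j≤M    = ∈-oneTo⁻ j∈
  in  + j / suc M , 0<j/[1+m] j M 0<j , j/[1+m]<1 j M (s≤s j≤M) ,
      few-collisions⇒many-values _≟ℤ_ (πⱼ (length S) M j) S few
  where
  B = ∑ S ℤ.∣_∣
  M = (B + B) !
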